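{- Let $\ell$ and $b$ be nonzero integers and let $\mathbf{s}$ be defined by $s_0=0$, $s_1=1$, and $s_j=\ell s_{j-1}+bs_{j-2}$ for $j\geq2$. Then $s_j>0$ for all $j\geq1$ if and only if $\ell>0$ and $\ell^2+4b\geq0$. -}

module Defs where

open import Data.Nat using (ℕ; zero; suc)
open import Data.Integer using (ℤ; _+_; _*_; 0ℤ; 1ℤ)

s : ℤ → ℤ → ℕ → ℤ
s ℓ b zero = 0ℤ
s ℓ b (suc zero) = 1ℤ
s ℓ b (suc (suc j)) = ℓ * s ℓ b (suc j) + b * s ℓ b j

module Submission where

-- (⇐) If ℓ > 0 and Δ ≥ 0, every consecutive pair (u, v) = (s_j, s_{j+1}) lies in
--     the cone u ≥ 0, v > 0, 2v ≥ ℓu, and one step of the recurrence maps the cone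
--     into itself, because 2(2w − ℓv) = ℓ(2v − ℓu) + Δu for w = ℓv + bu.
-- (⇒) Positivity gives ℓ = s₂ > 0.  If moreover Δ < 0, then b < 0, so the ratios
--     r_j = s_{j+1}/s_j satisfy r_{j+1} ≤ ℓ, and each step lowers any bound on the
--     ratio by at least −Δ/(4ℓ): in cleared-denominator form,
--     4ℓ s_{m+2} ≤ (4ℓ² + mΔ) s_{m+1} for all m.  At m = 4ℓ² the right-hand side
--     is 4ℓ²(1 + Δ) s_{m+1} ≤ 0, contradicting s_{m+2} > 0.

open import Defs
open import Data.Nat using (ℕ; suc; zero; z≤n; s≤s)
open import Data.Integer
  using (ℤ; _+_; _*_; _-_; -_; _<_; _≤_; 0ℤ; 1ℤ; +_; -[1+_]; +≤+; +<+; ∣_∣; _≤?_)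
open import Data.Integer.Base using (positive; nonNegative)
import Data.Integer.Properties as ℤₚ
open import Data.Integer.Tactic.RingSolver using (solve-∀)
open import Data.Product using (_×_; _,_)
open import Data.Empty using (⊥; ⊥-elim)
open import Function.Bundles using (_⇔_; mk⇔)
open import Relation.Nullary using (yes; no)
open import Relation.Binary.PropositionalEquality
  using (_≡_; _≢_; refl; sym; subst)

-- The discriminant of the characteristic polynomial x² − ℓx − b.
Δ : ℤ → ℤ → ℤ
Δ ℓ b = ℓ * ℓ + (+ 4) * b

0≤+ : ∀ {a c} → 0ℤ ≤ a → 0ℤ ≤ c → 0ℤ ≤ a + c
0≤+ = ℤₚ.+-mono-≤

0<+ : ∀ {a c} → 0ℤ < a → 0ℤ ≤ c → 0ℤ < a + c
0<+ = ℤₚ.+-mono-<-≤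

0≤* : ∀ {a c} → 0ℤ ≤ a → 0ℤ ≤ c → 0ℤ ≤ a * c
0≤* {a} {c} 0≤a 0≤c =
  subst (_≤ a * c) (ℤₚ.*-zeroʳ a) (ℤₚ.*-monoˡ-≤-nonNeg a ⦃ nonNegative 0≤a ⦄ 0≤c)

0<* : ∀ {a c} → 0ℤ < a → 0ℤ < c → 0ℤ < a * c
0<* {a} {c} 0<a 0<c =
  subst (_< a * c) (ℤₚ.*-zeroʳ a) (ℤₚ.*-monoˡ-<-pos a ⦃ positive 0<a ⦄ 0<c)

0≤square : ∀ x → 0ℤ ≤ x * x
0≤square (+ n)     = 0≤* {+ n} (+≤+ z≤n) (+≤+ z≤n)
0≤square -[1+ n ]  = +≤+ z≤n

cancel-0≤ : ∀ {u} x → 0ℤ < u → 0ℤ ≤ u * x → 0ℤ ≤ x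
cancel-0≤ {u} x 0<u 0≤ux = ℤₚ.*-cancelˡ-≤-pos 0ℤ x u ⦃ positive 0<u ⦄
  (subst (_≤ u * x) (sym (ℤₚ.*-zeroʳ u)) 0≤ux)

cancel-0< : ∀ {u} x → 0ℤ < u → 0ℤ < u * x → 0ℤ < x
cancel-0< {u} x 0<u 0<ux = ℤₚ.*-cancelˡ-<-nonNeg u ⦃ nonNegative (ℤₚ.<⇒≤ 0<u) ⦄
  (subst (_< u * x) (sym (ℤₚ.*-zeroʳ u)) 0<ux)

0≤-≡ : ∀ {a c} → 0ℤ ≤ a → a ≡ c → 0ℤ ≤ c
0≤-≡ p refl = p

0<-≡ : ∀ {a c} → 0ℤ < a → a ≡ c → 0ℤ < c
0<-≡ p refl = p

record Cone (ℓ u v : ℤ) : Set where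
  field
    u≥0   : 0ℤ ≤ u
    v>0   : 0ℤ < v
    slope : 0ℤ ≤ (+ 2) * v - ℓ * u

-- Twice the new slope is a nonnegative combination of the old slope and u.
slope-step : ∀ ℓ b u v →
  ℓ * ((+ 2) * v - ℓ * u) + (ℓ * ℓ + (+ 4) * b) * u
  ≡ (+ 2) * ((+ 2) * (ℓ * v + b * u) - ℓ * v)
slope-step = solve-∀

term-step : ∀ ℓ v w → ℓ * v + ((+ 2) * w - ℓ * v) ≡ (+ 2) * w
term-step = solve-∀

cone-step : ∀ {ℓ b u v} → 0ℤ < ℓ → 0ℤ ≤ Δ ℓ b →
            Cone ℓ u v → Cone ℓ v (ℓ * v + b * u)
cone-step {ℓ} {b} {u} {v} 0<ℓ 0≤Δ c = record
  { u≥0   = ℤₚ.<⇒≤ v>0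
  ; v>0   = cancel-0< {+ 2} w (+<+ (s≤s z≤n))
              (0<-≡ (0<+ (0<* 0<ℓ v>0) slope′) (term-step ℓ v w))
  ; slope = slope′
  }
  where
  open Cone c
  w : ℤ
  w = ℓ * v + b * u
  slope′ : 0ℤ ≤ (+ 2) * w - ℓ * v
  slope′ = cancel-0≤ {+ 2} _ (+<+ (s≤s z≤n))
    (0≤-≡ (0≤+ (0≤* (ℤₚ.<⇒≤ 0<ℓ) slope) (0≤* 0≤Δ u≥0)) (slope-step ℓ b u v))

s-in-cone : ∀ {ℓ b} → 0ℤ < ℓ → 0ℤ ≤ Δ ℓ b → ∀ j → Cone ℓ (s ℓ b j) (s ℓ b (suc j))
s-in-cone {ℓ} 0<ℓ 0≤Δ zero =
  record { u≥0 = +≤+ z≤n ; v>0 = +<+ (s≤s z≤n) ; slope = 0≤-≡ (+≤+ z≤n) (initial-slope ℓ) }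
  where
  initial-slope : ∀ ℓ → + 2 ≡ (+ 2) * 1ℤ - ℓ * 0ℤ
  initial-slope = solve-∀
s-in-cone 0<ℓ 0≤Δ (suc j) = cone-step 0<ℓ 0≤Δ (s-in-cone 0<ℓ 0≤Δ j)

-- For w = ℓv + bu, u times the new ratio gap (c + Δ)v − 4ℓw is a combination
-- of the old gap cu − 4ℓv, a square, and the gap ℓu − v, with coefficients
-- v, ℓ and −Δ.
decline-identity : ∀ ℓ b c u v →
  v * (c * u - (+ 4) * ℓ * v) + ℓ * (((+ 2) * v - ℓ * u) * ((+ 2) * v - ℓ * u))
    + (- (ℓ * ℓ + (+ 4) * b)) * (u * (ℓ * u - v))
  ≡ u * ((c + (ℓ * ℓ + (+ 4) * b)) * v - (+ 4) * ℓ * (ℓ * v + b * u))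
decline-identity = solve-∀

-- Ratio decline: when ℓ ≥ 0 and Δ ≤ 0, a pair with u > 0, v/u ≤ ℓ and
-- v/u ≤ c/(4ℓ) is followed by a pair (v, w) with w/v ≤ (c + Δ)/(4ℓ).
decline-step : ∀ {ℓ b c u v} → 0ℤ ≤ ℓ → 0ℤ ≤ - Δ ℓ b → 0ℤ < u → 0ℤ ≤ v →
               0ℤ ≤ ℓ * u - v → 0ℤ ≤ c * u - (+ 4) * ℓ * v →
               0ℤ ≤ (c + Δ ℓ b) * v - (+ 4) * ℓ * (ℓ * v + b * u)
decline-step {ℓ} {b} {c} {u} {v} 0≤ℓ 0≤-Δ 0<u 0≤v ratio≤ℓ ratio≤c =
  cancel-0≤ _ 0<u (0≤-≡ (0≤+ (0≤+ (0≤* 0≤v ratio≤c) (0≤* 0≤ℓ (0≤square slope)))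
                              (0≤* 0≤-Δ (0≤* (ℤₚ.<⇒≤ 0<u) ratio≤ℓ)))
                         (decline-identity ℓ b c u v))
  where
  slope : ℤ
  slope = (+ 2) * v - ℓ * u

-- Adding Δ to the coefficient e + MΔ gives e + (1 + M)Δ; for M = + m the
-- factor 1ℤ + + m is definitionally + (suc m).
coefficient-step : ∀ e d M x y → ((e + M * d) + d) * x - y ≡ (e + (1ℤ + M) * d) * x - y
coefficient-step = solve-∀

-- ℓ = s₂, so positivity of the sequence forces ℓ > 0.
ℓ-positive : ∀ {ℓ b} → (∀ j → 0ℤ < s ℓ b (suc j)) → 0ℤ < ℓ
ℓ-positive {ℓ} {b} pos = 0<-≡ (pos 1) (s₂≡ℓ ℓ b)
  where
  s₂≡ℓ : ∀ ℓ b → ℓ * 1ℤ + b * 0ℤ ≡ ℓ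
  s₂≡ℓ = solve-∀

module Negative-discriminant (ℓ b : ℤ) (pos : ∀ j → 0ℤ < s ℓ b (suc j))
                             (Δ<0 : Δ ℓ b < 0ℤ) where

  0<ℓ : 0ℤ < ℓ
  0<ℓ = ℓ-positive pos

  0≤s : ∀ j → 0ℤ ≤ s ℓ b j
  0≤s zero    = +≤+ z≤n
  0≤s (suc j) = ℤₚ.<⇒≤ (pos j)

  0≤-Δ : 0ℤ ≤ - Δ ℓ b
  0≤-Δ = ℤₚ.neg-mono-≤ (ℤₚ.<⇒≤ Δ<0)

  -- b ≤ 0, because 4(−b) = ℓ² − Δ.
  0≤-b : 0ℤ ≤ - b
  0≤-b = cancel-0≤ {+ 4} (- b) (+<+ (s≤s z≤n))
           (0≤-≡ (0≤+ (0≤square ℓ) 0≤-Δ) (four-minus-b ℓ b))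
    where
    four-minus-b : ∀ ℓ b → ℓ * ℓ + - (ℓ * ℓ + (+ 4) * b) ≡ (+ 4) * (- b)
    four-minus-b = solve-∀

  -- s_{m+2} ≤ ℓ s_{m+1}, the difference being (−b) s_m.
  ratio≤ℓ : ∀ m → 0ℤ ≤ ℓ * s ℓ b (suc m) - s ℓ b (suc (suc m))
  ratio≤ℓ m = 0≤-≡ (0≤* 0≤-b (0≤s m)) (remainder ℓ b (s ℓ b m) (s ℓ b (suc m)))
    where
    remainder : ∀ ℓ b u v → (- b) * u ≡ ℓ * v - (ℓ * v + b * u)
    remainder = solve-∀

  -- The starting coefficient: s₂ = ℓ s₁, i.e. 4ℓ s₂ ≤ 4ℓ² s₁.
  E : ℤ
  E = (+ 4) * (ℓ * ℓ)

  ratio-decline : ∀ m →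
    0ℤ ≤ (E + (+ m) * Δ ℓ b) * s ℓ b (suc m) - (+ 4) * ℓ * s ℓ b (suc (suc m))
  ratio-decline zero    = 0≤-≡ (+≤+ z≤n) (initial-ratio ℓ b)
    where
    initial-ratio : ∀ ℓ b →
      0ℤ ≡ ((+ 4) * (ℓ * ℓ) + 0ℤ * (ℓ * ℓ + (+ 4) * b)) * 1ℤ - (+ 4) * ℓ * (ℓ * 1ℤ + b * 0ℤ)
    initial-ratio = solve-∀
  ratio-decline (suc m) =
    0≤-≡ (decline-step {c = E + (+ m) * Δ ℓ b} (ℤₚ.<⇒≤ 0<ℓ) 0≤-Δ (pos m) (0≤s (suc (suc m)))
                       (ratio≤ℓ m) (ratio-decline m))
         (coefficient-step E (Δ ℓ b) (+ m) (s ℓ b (suc (suc m)))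
                           ((+ 4) * ℓ * s ℓ b (suc (suc (suc m)))))

  -- At m = 4ℓ² the coefficient is 4ℓ²(1 + Δ) ≤ 0, so the bound would force
  -- s_{m+2} ≤ 0: the quantity `bound` is both nonnegative and negative.
  absurd : ⊥
  absurd = ℤₚ.<⇒≱ bound<0 0≤bound
    where
    0≤E : 0ℤ ≤ E
    0≤E = 0≤* {+ 4} (+≤+ z≤n) (0≤square ℓ)
    N : ℕ
    N = ∣ E ∣
    u v : ℤ
    u = s ℓ b (suc N)
    v = s ℓ b (suc (suc N))
    bound : ℤ
    bound = (E + E * Δ ℓ b) * u - (+ 4) * ℓ * v
    0≤bound : 0ℤ ≤ bound
    0≤bound = subst (λ e → 0ℤ ≤ (E + e * Δ ℓ b) * u - (+ 4) * ℓ * v)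
                    (ℤₚ.0≤i⇒+∣i∣≡i 0≤E) (ratio-decline N)
    0≤-[1+Δ] : 0ℤ ≤ - (1ℤ + Δ ℓ b)
    0≤-[1+Δ] = ℤₚ.neg-mono-≤ (ℤₚ.i<j⇒suc[i]≤j Δ<0)
    negated : ℤ
    negated = (+ 4) * ℓ * v + E * (- (1ℤ + Δ ℓ b)) * u
    0<negated : 0ℤ < negated
    0<negated = 0<+ (0<* (0<* {+ 4} (+<+ (s≤s z≤n)) 0<ℓ) (pos (suc N)))
                    (0≤* (0≤* 0≤E 0≤-[1+Δ]) (0≤s (suc N)))
    negate : ∀ ℓ b u v →
      (+ 4) * ℓ * v + (+ 4) * (ℓ * ℓ) * (- (1ℤ + (ℓ * ℓ + (+ 4) * b))) * u
      ≡ - (((+ 4) * (ℓ * ℓ) + (+ 4) * (ℓ * ℓ) * (ℓ * ℓ + (+ 4) * b)) * u - (+ 4) * ℓ * v)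
    negate = solve-∀
    bound<0 : bound < 0ℤ
    bound<0 = ℤₚ.neg-cancel-< {0ℤ} {bound}
                (0<-≡ {negated} { - bound} 0<negated (negate ℓ b u v))

proposition3p1 : (ℓ b : ℤ) → ℓ ≢ 0ℤ → b ≢ 0ℤ →
    (((j : ℕ) → 0ℤ < s ℓ b (suc j)) ⇔ ((0ℤ < ℓ) × (0ℤ ≤ ℓ * ℓ + (+ 4) * b)))
proposition3p1 ℓ b _ _ = mk⇔ forward backward
  where
  forward : (∀ j → 0ℤ < s ℓ b (suc j)) → (0ℤ < ℓ) × (0ℤ ≤ Δ ℓ b)
  forward pos with 0ℤ ≤? Δ ℓ b
  ... | yes 0≤Δ = ℓ-positive pos , 0≤Δ
  ... | no  0≰Δ = ⊥-elim (Negative-discriminant.absurd ℓ b pos (ℤₚ.≰⇒> 0≰Δ))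

  backward : (0ℤ < ℓ) × (0ℤ ≤ Δ ℓ b) → ∀ j → 0ℤ < s ℓ b (suc j)
  backward (0<ℓ , 0≤Δ) j = Cone.v>0 (s-in-cone 0<ℓ 0≤Δ j)
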